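{- Every small type $A$ of $\mathsf{PTT_1}$ is equal (i.e. $\vdash A=B:\mathrm{U_0}$) to some type $B$ in opposite normal form, i.e. a type in which the opposite type constructor is applied only to type variables.
   Context: $\mathsf{PTT_1}$ is the following type theory. It has no basic types: types are generated from a countable set of type variables $\alpha,\alpha_1,\dots,\beta,\beta_1,\dots$ (standing for arbitrary, possibly dependent, basic types in $\mathrm{U_0}$). It extends the intensional fragment of Martin-Löf type theory with type constructors $\to,\times,+,\Pi,\Sigma$ (standard rules, term constructors $\lambda$, $\mathrm{Ap}$, $(\cdot,\cdot)$, $\mathrm{fst}$, $\mathrm{snd}$, $\mathrm{inl}$, $\mathrm{inr}$, $D$, $E$, computation rules) and universes $\mathrm{U_0}:\mathrm{U_1}$ ($\mathrm{U_1}$ closed under $\to$; $\mathrm{U_0}$ closed under all constructors below; types in $\mathrm{U_0}$ are small). Added: opposite types $\overline{A}:\mathrm{U_0}$ for $A:\mathrm{U_0}$ and co-function types $B\leftarrow A:\mathrm{U_0}$ for $A,B:\mathrm{U_0}$, with rules: from $a:A$ infer $a:\overline{\overline{A}}$ and conversely; from $a:A$, $b:\overline B$ infer $(a,b):\overline{A\to B}$; from $c:\overline{A\to B}$ infer $\mathrm{fst}(c):A$, $\mathrm{snd}(c):\overline B$; from $a:\overline A$ infer $\mathrm{inl}(a):\overline{A\times B}$; from $b:\overline B$ infer $\mathrm{inr}(b):\overline{A\times B}$; from $c:\overline{A\times B}$, $d(x):C(\mathrm{inl}(x))$ [$x:\overline A$], $e(y):C(\mathrm{inr}(y))$ [$y:\overline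 B$] infer $D(c,x.d,y.e):C(c)$; from $a:\overline A$, $b:\overline B$ infer $(a,b):\overline{A+B}$; from $c:\overline{A+B}$ infer $\mathrm{fst}(c):\overline A$, $\mathrm{snd}(c):\overline B$; from $a:A$, $b:\overline{B(a)}$ infer $(a,b):\overline{\Pi x:A.B(x)}$; from $c:\overline{\Pi x:A.B(x)}$, $d(x,y):C((x,y))$ [$x:A,y:\overline{B(x)}$] infer $E(c,(x,y).d):C(c)$; from $b(x):\overline{B(x)}$ [$x:A$] infer $\lambda x.b:\overline{\Sigma x:A.B(x)}$; from $c:\overline{\Sigma x:A.B(x)}$, $a:A$ infer $\mathrm{Ap}(c,a):\overline{B(a)}$; from $a:\overline A$, $b:B$ infer $(a,b):B\leftarrow A$; from $c:B\leftarrow A$ infer $\mathrm{fst}(c):\overline A$, $\mathrm{snd}(c):B$; from $b(x):\overline B$ [$x:\overline A$] infer $\lambda x.b:\overline{B\leftarrow A}$; from $c:\overline{B\leftarrow A}$, $a:\overline A$ infer $\mathrm{Ap}(c,a):\overline B$. Also: the usual computation rules; eta/co-eta rules $\lambda x.\mathrm{Ap}(c,x)=c:W$ ($W\in\{A\to B,\Pi x:A.B(x),\overline{B\leftarrow A},\overline{\Sigma x:A.B(x)}\}$), $(\mathrm{fst}(c),\mathrm{snd}(c))=c:X$ ($X\in\{A\times B,B\leftarrow A,\Sigma x:A.B(x),\overline{A+B},\overline{A\to B},\overline{\Pi x:A.B(x)}\}$), $D(c,x.\mathrm{inl}(x),y.\mathrm{inr}(y))=c:Y$ ($Y\in\{A+B,\overline{A\times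 B}\}$), $E(c,(x,y).(x,y))=c:Z$ ($Z\in\{\Sigma x:A.B(x),\overline{\Pi x:A.B(x)}\}$); and the type equality rules (for small $A,B$): $\overline{A\to B}=\overline B\leftarrow\overline A:\mathrm{U_0}$, $\overline{B\leftarrow A}=\overline A\to\overline B:\mathrm{U_0}$, $\overline{A\times B}=\overline A+\overline B:\mathrm{U_0}$, $\overline{A+B}=\overline A\times\overline B:\mathrm{U_0}$, $\overline{\Pi x:A.B}=\Sigma x:A.\overline B:\mathrm{U_0}$, $\overline{\Sigma x:A.B}=\Pi x:A.\overline B:\mathrm{U_0}$, $\overline{\overline A}=A:\mathrm{U_0}$. -}

module Defs where

open import Data.Nat using (ℕ; suc)
open import Data.Fin using (Fin)
open import Data.List using (List)

-- Raw, well-scoped (de Bruijn) syntax of PTT₁ terms (n = number of term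
-- variables in scope).  Binders: lam binds 1, D binds 1 in each branch,
-- E binds 2.
data Tm (n : ℕ) : Set where
  var  : Fin n → Tm n
  lam  : Tm (suc n) → Tm n
  ap   : Tm n → Tm n → Tm n
  pair : Tm n → Tm n → Tm n
  fst  : Tm n → Tm n
  snd  : Tm n → Tm n
  inl  : Tm n → Tm n
  inr  : Tm n → Tm n
  D    : Tm n → Tm (suc n) → Tm (suc n) → Tm n
  E    : Tm n → Tm (suc (suc n)) → Tm n

-- Small types (elements of U₀) of PTT₁.  A type variable α_i is possibly
-- dependent: it is applied to a list of terms (possibly empty).
infixr 20 _⇒_ _⇐_
infixr 22 _⊗_ _⊕_
data Ty (n : ℕ) : Set where
  tvar : ℕ → List (Tm n) → Ty n
  _⇒_  : Ty n → Ty n → Ty n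
  _⇐_  : Ty n → Ty n → Ty n
  _⊗_  : Ty n → Ty n → Ty n
  _⊕_  : Ty n → Ty n → Ty n
  Pi   : Ty n → Ty (suc n) → Ty n
  Sig  : Ty n → Ty (suc n) → Ty n
  op   : Ty n → Ty n

data OpNF {n : ℕ} : Ty n → Set where
  nf-var  : ∀ i ts → OpNF (tvar i ts)
  nf-opv  : ∀ i ts → OpNF (op (tvar i ts))
  nf-⇒    : ∀ {A B} → OpNF A → OpNF B → OpNF (A ⇒ B)
  nf-⇐    : ∀ {A B} → OpNF A → OpNF B → OpNF (B ⇐ A)
  nf-⊗    : ∀ {A B} → OpNF A → OpNF B → OpNF (A ⊗ B)
  nf-⊕    : ∀ {A B} → OpNF A → OpNF B → OpNF (A ⊕ B)
  nf-Pi   : ∀ {A B} → OpNF A → OpNF B → OpNF (Pi A B)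
  nf-Sig  : ∀ {A B} → OpNF A → OpNF B → OpNF (Sig A B)

-- Judgmental type equality  ⊢ A = B : U₀  (type-level fragment):
-- equivalence relation, congruence for all type formers, and the type
-- equality rules of PTT₁ for opposite types.
infix 4 _≐_
data _≐_ {n : ℕ} : Ty n → Ty n → Set where
  ≐-refl  : ∀ {A} → A ≐ A
  ≐-sym   : ∀ {A B} → A ≐ B → B ≐ A
  ≐-trans : ∀ {A B C} → A ≐ B → B ≐ C → A ≐ C
  ⇒-cong  : ∀ {A A′ B B′} → A ≐ A′ → B ≐ B′ → (A ⇒ B) ≐ (A′ ⇒ B′)
  ⇐-cong  : ∀ {A A′ B B′} → A ≐ A′ → B ≐ B′ → (B ⇐ A) ≐ (B′ ⇐ A′)
  ⊗-cong  : ∀ {A A′ B B′} → A ≐ A′ → B ≐ B′ → (A ⊗ B) ≐ (A′ ⊗ B′)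
  ⊕-cong  : ∀ {A A′ B B′} → A ≐ A′ → B ≐ B′ → (A ⊕ B) ≐ (A′ ⊕ B′)
  Pi-cong  : ∀ {A A′} {B B′ : Ty (suc n)} → A ≐ A′ → B ≐ B′ → Pi A B ≐ Pi A′ B′
  Sig-cong : ∀ {A A′} {B B′ : Ty (suc n)} → A ≐ A′ → B ≐ B′ → Sig A B ≐ Sig A′ B′
  op-cong : ∀ {A A′} → A ≐ A′ → op A ≐ op A′
  op-⇒   : ∀ {A B} → op (A ⇒ B) ≐ (op B ⇐ op A)
  op-⇐   : ∀ {A B} → op (B ⇐ A) ≐ (op A ⇒ op B)
  op-⊗   : ∀ {A B} → op (A ⊗ B) ≐ (op A ⊕ op B)
  op-⊕   : ∀ {A B} → op (A ⊕ B) ≐ (op A ⊗ op B)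
  op-Pi  : ∀ {A B} → op (Pi A B) ≐ Sig A (op B)
  op-Sig : ∀ {A B} → op (Sig A B) ≐ Pi A (op B)
  op-op  : ∀ {A} → op (op A) ≐ A

{-# OPTIONS --safe #-}
module Submission where

open import Defs
open import Data.Nat using (ℕ)
open import Data.Product using (Σ; _×_; _,_)

-- The type equality rules for opposite types are oriented left to right and
-- used to push every opposite inward until it reaches a type variable, where
-- it stays, or meets another opposite, which cancels it. The domain of Π and
-- Σ is not dualised by these rules, so it is normalised without an opposite.

mutual
  normalize : ∀ {n} → Ty n → Ty n
  normalize (tvar i ts) = tvar i ts
  normalize (A ⇒ B)     = normalize A ⇒ normalize B
  normalize (B ⇐ A)     = normalize B ⇐ normalize A
  normalize (A ⊗ B)     = normalize A ⊗ normalize B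
  normalize (A ⊕ B)     = normalize A ⊕ normalize B
  normalize (Pi A B)    = Pi (normalize A) (normalize B)
  normalize (Sig A B)   = Sig (normalize A) (normalize B)
  normalize (op A)      = normalizeOp A

  normalizeOp : ∀ {n} → Ty n → Ty n
  normalizeOp (tvar i ts) = op (tvar i ts)
  normalizeOp (A ⇒ B)     = normalizeOp B ⇐ normalizeOp A
  normalizeOp (B ⇐ A)     = normalizeOp A ⇒ normalizeOp B
  normalizeOp (A ⊗ B)     = normalizeOp A ⊕ normalizeOp B
  normalizeOp (A ⊕ B)     = normalizeOp A ⊗ normalizeOp B
  normalizeOp (Pi A B)    = Sig (normalize A) (normalizeOp B)
  normalizeOp (Sig A B)   = Pi (normalize A) (normalizeOp B)
  normalizeOp (op A)      = normalize A

mutual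
  normalize-OpNF : ∀ {n} (A : Ty n) → OpNF (normalize A)
  normalize-OpNF (tvar i ts) = nf-var i ts
  normalize-OpNF (A ⇒ B)     = nf-⇒ (normalize-OpNF A) (normalize-OpNF B)
  normalize-OpNF (B ⇐ A)     = nf-⇐ (normalize-OpNF A) (normalize-OpNF B)
  normalize-OpNF (A ⊗ B)     = nf-⊗ (normalize-OpNF A) (normalize-OpNF B)
  normalize-OpNF (A ⊕ B)     = nf-⊕ (normalize-OpNF A) (normalize-OpNF B)
  normalize-OpNF (Pi A B)    = nf-Pi (normalize-OpNF A) (normalize-OpNF B)
  normalize-OpNF (Sig A B)   = nf-Sig (normalize-OpNF A) (normalize-OpNF B)
  normalize-OpNF (op A)      = normalizeOp-OpNF A

  normalizeOp-OpNF : ∀ {n} (A : Ty n) → OpNF (normalizeOp A)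
  normalizeOp-OpNF (tvar i ts) = nf-opv i ts
  normalizeOp-OpNF (A ⇒ B)     = nf-⇐ (normalizeOp-OpNF A) (normalizeOp-OpNF B)
  normalizeOp-OpNF (B ⇐ A)     = nf-⇒ (normalizeOp-OpNF A) (normalizeOp-OpNF B)
  normalizeOp-OpNF (A ⊗ B)     = nf-⊕ (normalizeOp-OpNF A) (normalizeOp-OpNF B)
  normalizeOp-OpNF (A ⊕ B)     = nf-⊗ (normalizeOp-OpNF A) (normalizeOp-OpNF B)
  normalizeOp-OpNF (Pi A B)    = nf-Sig (normalize-OpNF A) (normalizeOp-OpNF B)
  normalizeOp-OpNF (Sig A B)   = nf-Pi (normalize-OpNF A) (normalizeOp-OpNF B)
  normalizeOp-OpNF (op A)      = normalize-OpNF A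

mutual
  ≐-normalize : ∀ {n} (A : Ty n) → A ≐ normalize A
  ≐-normalize (tvar i ts) = ≐-refl
  ≐-normalize (A ⇒ B)     = ⇒-cong (≐-normalize A) (≐-normalize B)
  ≐-normalize (B ⇐ A)     = ⇐-cong (≐-normalize A) (≐-normalize B)
  ≐-normalize (A ⊗ B)     = ⊗-cong (≐-normalize A) (≐-normalize B)
  ≐-normalize (A ⊕ B)     = ⊕-cong (≐-normalize A) (≐-normalize B)
  ≐-normalize (Pi A B)    = Pi-cong (≐-normalize A) (≐-normalize B)
  ≐-normalize (Sig A B)   = Sig-cong (≐-normalize A) (≐-normalize B)
  ≐-normalize (op A)      = op≐normalizeOp A

  op≐normalizeOp : ∀ {n} (A : Ty n) → op A ≐ normalizeOp A
  op≐normalizeOp (tvar i ts) = ≐-refl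
  op≐normalizeOp (A ⇒ B)     = ≐-trans op-⇒ (⇐-cong (op≐normalizeOp A) (op≐normalizeOp B))
  op≐normalizeOp (B ⇐ A)     = ≐-trans op-⇐ (⇒-cong (op≐normalizeOp A) (op≐normalizeOp B))
  op≐normalizeOp (A ⊗ B)     = ≐-trans op-⊗ (⊕-cong (op≐normalizeOp A) (op≐normalizeOp B))
  op≐normalizeOp (A ⊕ B)     = ≐-trans op-⊕ (⊗-cong (op≐normalizeOp A) (op≐normalizeOp B))
  op≐normalizeOp (Pi A B)    = ≐-trans op-Pi (Sig-cong (≐-normalize A) (op≐normalizeOp B))
  op≐normalizeOp (Sig A B)   = ≐-trans op-Sig (Pi-cong (≐-normalize A) (op≐normalizeOp B))
  op≐normalizeOp (op A)      = ≐-trans op-op (≐-normalize A)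

mainTheorem6 : ∀ {n : ℕ} (A : Ty n) → Σ (Ty n) (λ B → OpNF B × (A ≐ B))
mainTheorem6 A = normalize A , normalize-OpNF A , ≐-normalize A
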